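{- For every integer $n\ge 4$, the $(3,1)$ broadcast domination number of the $4\times n$ grid graph satisfies \[\gamma_{3,1}(G_{4,n})=\left\lfloor \frac{n+1}{7}\right\rfloor+\left\lfloor \frac{n+3}{7}\right\rfloor+\left\lfloor \frac{n+5}{7}\right\rfloor+1 .\]
   Context: For positive integers $m,n$, $G_{m,n}$ denotes the $m\times n$ grid graph (the Cartesian product of a path on $m$ vertices and a path on $n$ vertices). For a graph $G=(V,E)$ with shortest-path distance $d$ and integers $1\le r\le t$, the reception strength of $u\in V$ with respect to $S\subseteq V$ is $r(u)=\sum_{v\in S,\ d(u,v)<t}\bigl(t-d(u,v)\bigr)$. A set $S\subseteq V$ is a $(t,r)$ broadcast dominating set if $r(u)\ge r$ for every $u\in V$. The $(t,r)$ broadcast domination number $\gamma_{t,r}(G)$ is the minimum cardinality of a $(t,r)$ broadcast dominating set of $G$. -}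

module Defs where

open import Data.Nat using (ℕ; _+_; _*_; _∸_; _≤_; _<ᵇ_)
open import Data.Nat.Base using (∣_-_∣)
open import Data.Bool using (Bool; true; false; if_then_else_)
open import Data.Fin using (Fin; toℕ; zero; suc)
open import Relation.Binary.PropositionalEquality using (_≡_)
open import Data.Product using (_×_; _,_; ∃)

Vertex : ℕ → ℕ → Set
Vertex m n = Fin m × Fin n

-- Shortest-path distance in G_{m,n}: the grid graph's distance is the
-- Manhattan (ℓ¹) distance between coordinates.
dist : ∀ {m n} → Vertex m n → Vertex m n → ℕ
dist (i , j) (i' , j') = ∣ toℕ i - toℕ i' ∣ + ∣ toℕ j - toℕ j' ∣

sumFin : ∀ k → (Fin k → ℕ) → ℕ
sumFin ℕ.zero f = 0
sumFin (ℕ.suc k) f = f zero + sumFin k (λ x → f (suc x))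

sumV : ∀ m n → (Vertex m n → ℕ) → ℕ
sumV m n f = sumFin m (λ i → sumFin n (λ j → f (i , j)))

VSet : ℕ → ℕ → Set
VSet m n = Vertex m n → Bool

card : ∀ {m n} → VSet m n → ℕ
card {m} {n} S = sumV m n (λ v → if S v then 1 else 0)

-- Reception strength r(u) = Σ_{v ∈ S, d(u,v) < t} (t - d(u,v)).
-- (Truncated subtraction: t ∸ d = 0 exactly when d ≥ t.)
reception : ∀ {m n} → ℕ → VSet m n → Vertex m n → ℕ
reception {m} {n} t S u =
  sumV m n (λ v → if S v then (if dist u v <ᵇ t then t ∸ dist u v else 0) else 0)

IsBroadcastDom : ∀ {m n} → ℕ → ℕ → VSet m n → Set
IsBroadcastDom t r S = ∀ u → r ≤ reception t S u

BroadcastDomNumber : ℕ → ℕ → ℕ → ℕ → ℕ → Set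
BroadcastDomNumber m n t r k =
  (∃ λ (S : VSet m n) → IsBroadcastDom t r S × card S ≡ k)
  × (∀ (S : VSet m n) → IsBroadcastDom t r S → k ≤ card S)

{-# OPTIONS --safe #-}
-- For t = 3 and r = 1 a vertex is dominated exactly when S has a vertex within distance 2 of
-- it, so whether column K is dominated depends only on the columns K − 2, …, K + 2. Reading
-- the columns from left to right, all that matters about the last four is their profile: what
-- they already cover of the columns still open, and the last column itself. Only 105 profiles
-- occur, and they carry levels h such that reading a column of weight w from a profile of
-- level h leads to a profile of level at most h + 7w − 3. Comparing the levels of the first
-- and the last profile gives 7|S| ≥ 3n + 4, and the formula is the least integer allowed by
-- this bound. Conversely, a column pattern of period 14 and weight 6, closed off by one column
-- chosen according to n mod 14, attains it.
module Submission where

open import Defs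
open import Data.Bool using (Bool; true; false; T; _∧_; _∨_; if_then_else_)
open import Data.Bool.ListAction using (any)
open import Data.Bool.Properties using (T-∨; T-∧) renaming (_≟_ to _≟ᵇ_)
open import Data.Empty using (⊥-elim)
open import Data.Fin using (Fin; zero; suc; toℕ; fromℕ<)
open import Data.Fin.Properties using (any?; all?; toℕ-fromℕ<; fromℕ<-toℕ; toℕ<n; toℕ-injective)
open import Data.List as List using (List; []; _∷_; _++_; length; take; drop; concat)
open import Data.List.Membership.Propositional using (_∈_; find)
open import Data.List.Properties using (++-assoc; length-++)
open import Data.List.Relation.Unary.All as All using (All)
open import Data.List.Relation.Unary.Any.Properties using (any⁻)
open import Data.Nat
  using (ℕ; zero; suc; _+_; _*_; _∸_; _/_; _%_; _≤_; _<_; _≤ᵇ_; _<ᵇ_; _≡ᵇ_; z≤n; s≤s; z<s; s<s)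
open import Data.Nat.Base using (∣_-_∣)
open import Data.Nat.DivMod using (m*n/n≡m; +-distrib-/-∣ʳ; _divMod_; result)
open import Data.Nat.Divisibility using (divides)
open import Data.Nat.Properties
open import Data.Nat.Tactic.RingSolver using (solve-∀)
open import Data.Product using (∃; _×_; _,_; proj₁; proj₂)
open import Data.Sum using (_⊎_; inj₁; inj₂; [_,_])
open import Data.Unit using (tt)
open import Data.Vec using (Vec; []; _∷_; lookup; tabulate; zipWith; replicate; map)
open import Data.Vec.Functional using (foldl)
open import Data.Vec.Properties
  using (lookup∘tabulate; tabulate∘lookup; lookup-zipWith; lookup-replicate; ≡-dec)
open import Function using (_∘_; id; _⇔_; mk⇔; Equivalence)
open import Relation.Binary.Definitions using (DecidableEquality)
open import Relation.Binary.PropositionalEquality hiding ([_])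
open import Relation.Nullary using (¬_; Dec; yes; no; map′; _×-dec_; _→-dec_; contradiction)
open import Relation.Nullary.Decidable using (⌊_⌋; T?; toWitness; fromWitness; from-yes)
import Algebra.Properties.CommutativeMonoid.Sum as FinSum

private
  module ∑ = FinSum +-0-commutativeMonoid
  variable
    m n : ℕ

sumFin≡∑ : ∀ k (f : Fin k → ℕ) → sumFin k f ≡ ∑.sum f
sumFin≡∑ zero    f = refl
sumFin≡∑ (suc k) f = cong (f zero +_) (sumFin≡∑ k (f ∘ suc))

sumFin-cong : ∀ k {f g : Fin k → ℕ} → (∀ i → f i ≡ g i) → sumFin k f ≡ sumFin k g
sumFin-cong zero    f≗g = refl
sumFin-cong (suc k) f≗g = cong₂ _+_ (f≗g zero) (sumFin-cong k (f≗g ∘ suc))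

sumFin-comm : ∀ k l (f : Fin k → Fin l → ℕ) →
              sumFin k (λ i → sumFin l (f i)) ≡ sumFin l (λ j → sumFin k (λ i → f i j))
sumFin-comm k l f = begin
  sumFin k (λ i → sumFin l (f i))          ≡⟨ sumFin-cong k (λ i → sumFin≡∑ l (f i)) ⟩
  sumFin k (λ i → ∑.sum (f i))             ≡⟨ sumFin≡∑ k _ ⟩
  ∑.sum (λ i → ∑.sum (f i))                ≡⟨ ∑.∑-comm f ⟩
  ∑.sum (λ j → ∑.sum (λ i → f i j))        ≡⟨ sumFin≡∑ l _ ⟨
  sumFin l (λ j → ∑.sum (λ i → f i j))     ≡⟨ sumFin-cong l (λ j → sumFin≡∑ k (λ i → f i j)) ⟨
  sumFin l (λ j → sumFin k (λ i → f i j))  ∎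
  where open ≡-Reasoning

sumFin-pos : ∀ k (f : Fin k → ℕ) → 0 < sumFin k f → ∃ λ i → 0 < f i
sumFin-pos (suc k) f pos with f zero in eq
... | suc _ = zero , subst (0 <_) (sym eq) z<s
... | zero  = let i , posᵢ = sumFin-pos k (f ∘ suc) pos in suc i , posᵢ

≤-sumFin : ∀ k (f : Fin k → ℕ) i → f i ≤ sumFin k f
≤-sumFin (suc k) f zero    = m≤m+n (f zero) _
≤-sumFin (suc k) f (suc i) = ≤-trans (≤-sumFin k (f ∘ suc) i) (m≤n+m _ (f zero))

contribution-pos : ∀ b t d → 0 < (if b then (if d <ᵇ t then t ∸ d else 0) else 0) ⇔ (T b × d < t)
contribution-pos false t d = mk⇔ (λ ()) (λ ())
contribution-pos true  t d with d <ᵇ t in eq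
... | true  = mk⇔ (λ _ → _ , <ᵇ⇒< d t (subst T (sym eq) _)) (m<n⇒0<n∸m ∘ proj₂)
... | false = mk⇔ (λ ()) (λ (_ , d<t) → ⊥-elim (subst T eq (<⇒<ᵇ d<t)))

reception-pos : ∀ t (S : VSet m n) u → 0 < reception t S u ⇔ ∃ λ v → T (S v) × dist u v < t
reception-pos {m} {n} t S u = mk⇔ to from
  where
  contribution : Vertex m n → ℕ
  contribution v = if S v then (if dist u v <ᵇ t then t ∸ dist u v else 0) else 0

  to : 0 < reception t S u → ∃ λ v → T (S v) × dist u v < t
  to pos =
    let i , posᵢ  = sumFin-pos m _ pos
        j , posᵢⱼ = sumFin-pos n _ posᵢ
    in (i , j) , Equivalence.to (contribution-pos (S (i , j)) t _) posᵢⱼ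

  from : (∃ λ v → T (S v) × dist u v < t) → 0 < reception t S u
  from ((i , j) , v∈S , near) = begin-strict
    0                     <⟨ Equivalence.from (contribution-pos (S (i , j)) t _) (v∈S , near) ⟩
    contribution (i , j)  ≤⟨ ≤-sumFin n (λ j → contribution (i , j)) j ⟩
    row i                 ≤⟨ ≤-sumFin m row i ⟩
    reception t S u       ∎
    where
    open ≤-Reasoning
    row : Fin m → ℕ
    row i = sumFin n (λ j → contribution (i , j))

Col : ℕ → Set
Col m = Vec Bool m

∅ : Col m
∅ = replicate _ false

infixl 6 _∪_

_∪_ : Col m → Col m → Col m
_∪_ = zipWith _∨_

⋃ : ∀ {k} → (Fin k → Col m) → Col m
⋃ = foldl _∪_ ∅

-- The rows within distance 2 of a vertex of x, for x lying δ columns away. It is unfolded only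
-- where the certificates evaluate it, so that profiles of symbolic columns are compared
-- without computing it.
opaque
  spread : ℕ → Col m → Col m
  spread δ x = tabulate λ r →
    ⌊ any? (λ r′ → (∣ toℕ r - toℕ r′ ∣ + δ ≤? 2) ×-dec T? (lookup x r′)) ⌋

weight : Col m → ℕ
weight {m} x = sumFin m λ r → if lookup x r then 1 else 0

∅-empty : ∀ (r : Fin m) → ¬ T (lookup ∅ r)
∅-empty r = subst T (lookup-replicate r false)

∪-⇔ : ∀ (x y : Col m) r → T (lookup (x ∪ y) r) ⇔ (T (lookup x r) ⊎ T (lookup y r))
∪-⇔ x y r = subst (λ b → T b ⇔ (T (lookup x r) ⊎ T (lookup y r))) (sym (lookup-zipWith _∨_ r x y)) T-∨

foldl-∪-⇔ : ∀ k acc (f : Fin k → Col m) r →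
            T (lookup (foldl _∪_ acc f) r) ⇔ (T (lookup acc r) ⊎ ∃ λ i → T (lookup (f i) r))
foldl-∪-⇔ zero    acc f r = mk⇔ inj₁ [ id , (λ ()) ]
foldl-∪-⇔ (suc k) acc f r = mk⇔ to from
  where
  ih = foldl-∪-⇔ k (acc ∪ f zero) (f ∘ suc) r
  open Equivalence (∪-⇔ acc (f zero) r) renaming (to to split; from to join)

  Goal = T (lookup acc r) ⊎ ∃ λ i → T (lookup (f i) r)

  to : T (lookup (foldl _∪_ (acc ∪ f zero) (f ∘ suc)) r) → Goal
  to h with Equivalence.to ih h
  ... | inj₂ (i , r∈fᵢ) = inj₂ (suc i , r∈fᵢ)
  ... | inj₁ r∈acc∪f₀ with split r∈acc∪f₀
  ...   | inj₁ r∈acc = inj₁ r∈acc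
  ...   | inj₂ r∈f₀  = inj₂ (zero , r∈f₀)

  from : Goal → T (lookup (foldl _∪_ (acc ∪ f zero) (f ∘ suc)) r)
  from (inj₁ r∈acc)          = Equivalence.from ih (inj₁ (join (inj₁ r∈acc)))
  from (inj₂ (zero , r∈f₀))  = Equivalence.from ih (inj₁ (join (inj₂ r∈f₀)))
  from (inj₂ (suc i , r∈fᵢ)) = Equivalence.from ih (inj₂ (i , r∈fᵢ))

⋃-⇔ : ∀ {k} (f : Fin k → Col m) r → T (lookup (⋃ f) r) ⇔ ∃ λ i → T (lookup (f i) r)
⋃-⇔ f r = mk⇔ ([ ⊥-elim ∘ ∅-empty r , id ] ∘ Equivalence.to (foldl-∪-⇔ _ ∅ f r))
              (Equivalence.from (foldl-∪-⇔ _ ∅ f r) ∘ inj₂)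

opaque
  unfolding spread

  spread-⇔ : ∀ δ (x : Col m) r →
             T (lookup (spread δ x) r) ⇔ ∃ λ r′ → ∣ toℕ r - toℕ r′ ∣ + δ ≤ 2 × T (lookup x r′)
  spread-⇔ δ x r = subst (λ b → T b ⇔ Near) (sym (lookup∘tabulate _ r)) (mk⇔ toWitness fromWitness)
    where
    Near : Set
    Near = ∃ λ r′ → ∣ toℕ r - toℕ r′ ∣ + δ ≤ 2 × T (lookup x r′)

column : VSet m n → Fin n → Col m
column S k = tabulate λ r → S (r , k)

lookup-column : (S : VSet m n) (k : Fin n) (r : Fin m) → lookup (column S k) r ≡ S (r , k)
lookup-column S k = lookup∘tabulate (λ r → S (r , k))

card-by-columns : (S : VSet m n) → card S ≡ sumFin n (weight ∘ column S)
card-by-columns {m} {n} S = begin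
  card S                                   ≡⟨ sumFin-comm m n χ ⟩
  sumFin n (λ k → sumFin m (λ r → χ r k))  ≡⟨ sumFin-cong n (λ k → sumFin-cong m λ r →
                                                cong (λ b → if b then 1 else 0) (lookup-column S k r)) ⟨
  sumFin n (weight ∘ column S)             ∎
  where
  open ≡-Reasoning
  χ : Fin m → Fin n → ℕ
  χ r k = if S (r , k) then 1 else 0

columnAt : VSet m n → ℕ → Col m
columnAt {n = n} S j with j <? n
... | yes j<n = column S (fromℕ< j<n)
... | no  _   = ∅

columnAt-toℕ : (S : VSet m n) (k : Fin n) → columnAt S (toℕ k) ≡ column S k
columnAt-toℕ {n = n} S k with toℕ k <? n
... | yes k<n = cong (column S) (fromℕ<-toℕ k k<n)
... | no  k≮n = contradiction (toℕ<n k) k≮n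

columnAt-≥ : (S : VSet m n) {j : ℕ} → n ≤ j → columnAt S j ≡ ∅
columnAt-≥ {n = n} S {j} n≤j with j <? n
... | yes j<n = contradiction n≤j (<⇒≱ j<n)
... | no  _   = refl

columnAt-⇔ : (S : VSet m n) → ∀ j r →
             T (lookup (columnAt S j) r) ⇔ ∃ λ k → toℕ k ≡ j × T (S (r , k))
columnAt-⇔ {n = n} S j r with j <? n
... | no  j≮n = mk⇔ (⊥-elim ∘ ∅-empty r) λ (k , k≡j , _) → contradiction (subst (_< n) k≡j (toℕ<n k)) j≮n
... | yes j<n = mk⇔ (λ r∈ → k , toℕ-fromℕ< j<n , subst T (lookup-column S k r) r∈)
                    (λ (k′ , k′≡j , k′∈S) →
                       subst T (sym (lookup-column S k r)) (subst (T ∘ S ∘ (r ,_)) (k′≡k k′≡j) k′∈S))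
  where
  k = fromℕ< j<n
  k′≡k : ∀ {k′} → toℕ k′ ≡ j → k′ ≡ k
  k′≡k k′≡j = toℕ-injective (trans k′≡j (sym (toℕ-fromℕ< j<n)))

-- pad c j is column j − 2 of c, so that the window pad c K, …, pad c (4 + K) is centred on
-- column K of c.
pad : (ℕ → Col m) → ℕ → Col m
pad c zero          = ∅
pad c (suc zero)    = ∅
pad c (suc (suc j)) = c j

pad-columnAt-⇔ : (S : VSet m n) → ∀ j r →
                 T (lookup (pad (columnAt S) j) r) ⇔ ∃ λ k → 2 + toℕ k ≡ j × T (S (r , k))
pad-columnAt-⇔ S zero          r = mk⇔ (⊥-elim ∘ ∅-empty r) λ { (_ , () , _) }
pad-columnAt-⇔ S (suc zero)    r = mk⇔ (⊥-elim ∘ ∅-empty r) λ { (_ , () , _) }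
pad-columnAt-⇔ S (suc (suc j)) r =
  mk⇔ (λ r∈ → let k , k≡j , k∈S = to r∈ in k , cong (2 +_) k≡j , k∈S)
      (λ (k , eq , k∈S) → from (k , suc-injective (suc-injective eq) , k∈S))
  where open Equivalence (columnAt-⇔ S j r)

coverage : (ℕ → Col m) → ℕ → Col m
coverage p K = ⋃ λ (i : Fin 5) → spread ∣ toℕ i - 2 ∣ (p (toℕ i + K))

offset-distance : ∀ o k k′ → o + k ≡ 2 + k′ → ∣ o - 2 ∣ ≡ ∣ k - k′ ∣
offset-distance o k k′ eq = begin
  ∣ o - 2 ∣           ≡⟨ ∣m+n-m+o∣≡∣n-o∣ k o 2 ⟨
  ∣ k + o - k + 2 ∣   ≡⟨ cong₂ ∣_-_∣ (trans (+-comm k o) eq) (+-comm k 2) ⟩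
  ∣ 2 + k′ - 2 + k ∣  ≡⟨ ∣m+n-m+o∣≡∣n-o∣ 2 k′ k ⟩
  ∣ k′ - k ∣          ≡⟨ ∣-∣-comm k′ k ⟩
  ∣ k - k′ ∣          ∎
  where open ≡-Reasoning

column-offset : ∀ k k′ → ∣ k - k′ ∣ ≤ 2 → ∃ λ (i : Fin 5) → toℕ i + k ≡ 2 + k′
column-offset k k′ near = fromℕ< o<5 , trans (cong (_+ k) (toℕ-fromℕ< o<5)) (m∸n+n≡m k≤2+k′)
  where
  open ≤-Reasoning
  k≤2+k′ : k ≤ 2 + k′
  k≤2+k′ = begin
    k                ≤⟨ m≤n+∣m-n∣ k k′ ⟩
    k′ + ∣ k - k′ ∣  ≤⟨ +-monoʳ-≤ k′ near ⟩
    k′ + 2           ≡⟨ +-comm k′ 2 ⟩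
    2 + k′           ∎
  k′≤2+k : k′ ≤ 2 + k
  k′≤2+k = begin
    k′               ≤⟨ m≤n+∣n-m∣ k′ k ⟩
    k + ∣ k - k′ ∣   ≤⟨ +-monoʳ-≤ k near ⟩
    k + 2            ≡⟨ +-comm k 2 ⟩
    2 + k            ∎
  o<5 : 2 + k′ ∸ k < 5
  o<5 = begin-strict
    2 + k′ ∸ k       ≤⟨ ∸-monoˡ-≤ k (+-monoʳ-≤ 2 k′≤2+k) ⟩
    4 + k ∸ k        ≡⟨ m+n∸n≡m 4 k ⟩
    4                <⟨ n<1+n 4 ⟩
    5                ∎

covered⇔dominated : (S : VSet m n) → ∀ r k →
                    T (lookup (coverage (pad (columnAt S)) (toℕ k)) r) ⇔ ∃ λ v → T (S v) × dist (r , k) v < 3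
covered⇔dominated S r k = mk⇔ to from
  where
  p = pad (columnAt S)
  window : Fin 5 → Col _
  window i = spread ∣ toℕ i - 2 ∣ (p (toℕ i + toℕ k))
  near-row : ∀ {i r′ k′} → toℕ i + toℕ k ≡ 2 + toℕ k′ →
             ∣ toℕ r - toℕ r′ ∣ + ∣ toℕ i - 2 ∣ ≡ dist (r , k) (r′ , k′)
  near-row {i} {r′} {k′} eq = cong (∣ toℕ r - toℕ r′ ∣ +_) (offset-distance (toℕ i) (toℕ k) (toℕ k′) eq)

  to : T (lookup (⋃ window) r) → ∃ λ v → T (S v) × dist (r , k) v < 3
  to r∈ with Equivalence.to (⋃-⇔ window r) r∈
  ... | i , r∈ᵢ with Equivalence.to (spread-⇔ _ (p (toℕ i + toℕ k)) r) r∈ᵢ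
  ...   | r′ , near , occupied with Equivalence.to (pad-columnAt-⇔ S (toℕ i + toℕ k) r′) occupied
  ...     | k′ , eq , v∈S = (r′ , k′) , v∈S , s≤s (subst (_≤ 2) (near-row {i} (sym eq)) near)

  from : (∃ λ v → T (S v) × dist (r , k) v < 3) → T (lookup (⋃ window) r)
  from ((r′ , k′) , v∈S , s≤s near) =
    let i , eq = column-offset (toℕ k) (toℕ k′) (m+n≤o⇒n≤o _ near)
        occupied = Equivalence.from (pad-columnAt-⇔ S (toℕ i + toℕ k) r′) (k′ , sym eq , v∈S)
        r∈ᵢ = Equivalence.from (spread-⇔ _ (p (toℕ i + toℕ k)) r)
                (r′ , subst (_≤ 2) (sym (near-row {i} eq)) near , occupied)
    in Equivalence.from (⋃-⇔ window r) (i , r∈ᵢ)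

-- Window profiles

-- The profile of the columns p K, …, p (3 + K): the rows of the columns 2 + K, 3 + K and
-- 4 + K that they cover, and their last column p (3 + K).
record Profile (m : ℕ) : Set where
  constructor profile
  field
    centre next beyond last : Col m
open Profile using (centre)

profileOf : Col m → Col m → Col m → Col m → Profile m
profileOf a b c d = profile (∅ ∪ spread 2 a ∪ spread 1 b ∪ spread 0 c ∪ spread 1 d)
                            (∅ ∪ spread 2 b ∪ spread 1 c ∪ spread 0 d)
                            (∅ ∪ spread 2 c ∪ spread 1 d)
                            d

profileAt : (ℕ → Col m) → ℕ → Profile m
profileAt p K = profileOf (p K) (p (1 + K)) (p (2 + K)) (p (3 + K))

advance : Profile m → Col m → Profile m
advance (profile _ next beyond last) e =
  profile (next ∪ spread 1 e) (beyond ∪ spread 0 e) (∅ ∪ spread 2 last ∪ spread 1 e) e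

-- Admits (profileAt p K) (p (4 + K)) unfolds to ∀ r → T (lookup (coverage p K) r).
Admits : Profile m → Col m → Set
Admits s e = ∀ r → T (lookup (centre s ∪ spread 2 e) r)

admits : Profile m → Col m → Bool
admits s e = ⌊ all? (λ r → T? (lookup (centre s ∪ spread 2 e) r)) ⌋

admits-⇔ : (s : Profile m) (e : Col m) → T (admits s e) ⇔ Admits s e
admits-⇔ s e = mk⇔ toWitness fromWitness

dominating⇒admits : (S : VSet m n) → IsBroadcastDom 3 1 S →
                    ∀ K → K < n → Admits (profileAt (pad (columnAt S)) K) (pad (columnAt S) (4 + K))
dominating⇒admits S dom K K<n r =
  subst (λ K → T (lookup (coverage (pad (columnAt S)) K) r)) (toℕ-fromℕ< K<n)
    (Equivalence.from (covered⇔dominated S r k) (Equivalence.to (reception-pos 3 S (r , k)) (dom (r , k))))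
  where k = fromℕ< K<n

admits⇒dominating : (S : VSet m n) →
                    (∀ K → K < n → Admits (profileAt (pad (columnAt S)) K) (pad (columnAt S) (4 + K))) →
                    IsBroadcastDom 3 1 S
admits⇒dominating S admitted (r , k) =
  Equivalence.from (reception-pos 3 S (r , k))
    (Equivalence.to (covered⇔dominated S r k) (admitted (toℕ k) (toℕ<n k) r))

infix 4 _≟ᶜ_ _≟ₚ_

_≟ᶜ_ : DecidableEquality (Col m)
_≟ᶜ_ = ≡-dec _≟ᵇ_

_≟ₚ_ : DecidableEquality (Profile m)
profile a b c d ≟ₚ profile a′ b′ c′ d′ =
  map′ (λ { (refl , refl , refl , refl) → refl }) (λ { refl → refl , refl , refl , refl })
       (a ≟ᶜ a′ ×-dec b ≟ᶜ b′ ×-dec c ≟ᶜ c′ ×-dec d ≟ᶜ d′)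

∀-Col? : {P : Col m → Set} → (∀ x → Dec (P x)) → Dec (∀ x → P x)
∀-Col? {zero}  P? = map′ (λ p → λ { [] → p }) (λ f → f []) (P? [])
∀-Col? {suc m} P? = map′ (λ (f , t) → λ { (false ∷ x) → f x ; (true ∷ x) → t x })
                         (λ g → g ∘ (false ∷_) , g ∘ (true ∷_))
                         (∀-Col? (P? ∘ (false ∷_)) ×-dec ∀-Col? (P? ∘ (true ∷_)))

bits : ℕ → Col m
bits {zero}  _ = []
bits {suc m} c = (c % 2 ≡ᵇ 1) ∷ bits (c / 2)

entry : ℕ → ℕ → ℕ → ℕ → ℕ → Profile 4 × ℕ
entry c nx b l h = profile (bits c) (bits nx) (bits b) (bits l) , h

-- The profiles that occur, each with its level: the least value of 7 · (weight read) − 3 ·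
-- (windows checked) over the ways of reaching it from a start profileOf ∅ ∅ x y, as found by
-- a shortest-path search.
levels : List (Profile 4 × ℕ)
levels =
  entry 0 0 0 0 0 ∷ entry 1 0 0 0 9 ∷ entry 2 0 0 0 4 ∷ entry 3 0 0 0 9 ∷
  entry 3 1 0 0 5 ∷ entry 3 7 3 1 7 ∷ entry 4 0 0 0 4 ∷ entry 5 0 0 0 5 ∷
  entry 6 0 0 0 5 ∷ entry 7 0 0 0 12 ∷ entry 7 1 0 0 5 ∷ entry 7 2 0 0 4 ∷
  entry 7 3 0 0 10 ∷ entry 7 3 1 0 7 ∷ entry 7 7 3 1 8 ∷ entry 7 15 7 2 7 ∷
  entry 7 15 7 3 14 ∷ entry 8 0 0 0 9 ∷ entry 9 0 0 0 5 ∷ entry 10 0 0 0 5 ∷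
  entry 11 0 0 0 12 ∷ entry 11 1 0 0 6 ∷ entry 11 7 3 1 9 ∷ entry 12 0 0 0 9 ∷
  entry 12 8 0 0 5 ∷ entry 12 14 12 8 7 ∷ entry 13 0 0 0 12 ∷ entry 13 8 0 0 6 ∷
  entry 13 14 12 8 9 ∷ entry 14 0 0 0 12 ∷ entry 14 4 0 0 4 ∷ entry 14 8 0 0 5 ∷
  entry 14 12 0 0 10 ∷ entry 14 12 8 0 7 ∷ entry 14 14 12 8 8 ∷ entry 14 15 14 4 7 ∷
  entry 14 15 14 12 14 ∷ entry 15 0 0 0 16 ∷ entry 15 1 0 0 12 ∷ entry 15 2 0 0 7 ∷
  entry 15 3 0 0 12 ∷ entry 15 3 1 0 8 ∷ entry 15 4 0 0 7 ∷ entry 15 5 0 0 8 ∷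
  entry 15 6 0 0 8 ∷ entry 15 7 0 0 15 ∷ entry 15 7 1 0 8 ∷ entry 15 7 2 0 7 ∷
  entry 15 7 3 0 13 ∷ entry 15 7 3 1 11 ∷ entry 15 8 0 0 12 ∷ entry 15 9 0 0 8 ∷
  entry 15 10 0 0 8 ∷ entry 15 11 0 0 15 ∷ entry 15 11 1 0 9 ∷ entry 15 12 0 0 12 ∷
  entry 15 12 8 0 8 ∷ entry 15 13 0 0 15 ∷ entry 15 13 8 0 9 ∷ entry 15 14 0 0 15 ∷
  entry 15 14 4 0 7 ∷ entry 15 14 8 0 8 ∷ entry 15 14 12 0 13 ∷ entry 15 14 12 8 11 ∷
  entry 15 15 0 0 19 ∷ entry 15 15 1 0 15 ∷ entry 15 15 2 0 10 ∷ entry 15 15 3 0 15 ∷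
  entry 15 15 3 1 11 ∷ entry 15 15 4 0 10 ∷ entry 15 15 5 0 11 ∷ entry 15 15 6 0 11 ∷
  entry 15 15 7 0 18 ∷ entry 15 15 7 1 11 ∷ entry 15 15 7 2 10 ∷ entry 15 15 7 3 16 ∷
  entry 15 15 8 0 15 ∷ entry 15 15 9 0 11 ∷ entry 15 15 10 0 11 ∷ entry 15 15 11 0 18 ∷
  entry 15 15 11 1 12 ∷ entry 15 15 12 0 15 ∷ entry 15 15 12 8 11 ∷ entry 15 15 13 0 18 ∷
  entry 15 15 13 8 12 ∷ entry 15 15 14 0 18 ∷ entry 15 15 14 4 10 ∷ entry 15 15 14 8 11 ∷
  entry 15 15 14 12 16 ∷ entry 15 15 15 0 22 ∷ entry 15 15 15 1 18 ∷ entry 15 15 15 2 13 ∷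
  entry 15 15 15 3 18 ∷ entry 15 15 15 4 13 ∷ entry 15 15 15 5 14 ∷ entry 15 15 15 6 14 ∷
  entry 15 15 15 7 21 ∷ entry 15 15 15 8 18 ∷ entry 15 15 15 9 14 ∷ entry 15 15 15 10 14 ∷
  entry 15 15 15 11 21 ∷ entry 15 15 15 12 18 ∷ entry 15 15 15 13 21 ∷ entry 15 15 15 14 21 ∷
  entry 15 15 15 15 25 ∷
  []

rated : List (Profile m × ℕ) → Profile m → (ℕ → Bool) → Bool
rated table s p = any (λ (s′ , h) → ⌊ s′ ≟ₚ s ⌋ ∧ p h) table

rated-sound : ∀ table (s : Profile m) p → T (rated table s p) → ∃ λ h → (s , h) ∈ table × T (p h)
rated-sound table s p r with find (any⁻ _ table r)
... | (s′ , h) , sh∈table , match with Equivalence.to T-∧ match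
...   | s′≡s , ph with toWitness {a? = s′ ≟ₚ s} s′≡s
...     | refl = h , sh∈table , ph

opaque
  unfolding spread

  start-certified : ∀ x y → T (rated levels (profileOf ∅ ∅ x y) (_≤ᵇ 7 * (weight x + weight y)))
  start-certified = from-yes (∀-Col? λ x → ∀-Col? λ y →
    T? (rated levels (profileOf ∅ ∅ x y) (_≤ᵇ 7 * (weight x + weight y))))

  step-certified : All (λ (s , h) → ∀ e → T (admits s e) →
                          T (rated levels (advance s e) (λ h′ → h′ + 3 ≤ᵇ h + 7 * weight e)))
                       levels
  step-certified = from-yes (All.all? (λ (s , h) → ∀-Col? λ e →
    T? (admits s e) →-dec T? (rated levels (advance s e) (λ h′ → h′ + 3 ≤ᵇ h + 7 * weight e))) levels)

  end-certified : All (λ (s , h) → T (admits s ∅) → T (admits (advance s ∅) ∅) → 10 ≤ h) levels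
  end-certified = from-yes (All.all? (λ (s , h) →
    T? (admits s ∅) →-dec T? (admits (advance s ∅) ∅) →-dec 10 ≤? h) levels)

start-level : ∀ x y → ∃ λ h → (profileOf ∅ ∅ x y , h) ∈ levels × h ≤ 7 * (weight x + weight y)
start-level x y =
  let h , sh∈levels , h≤ = rated-sound levels (profileOf ∅ ∅ x y) (_≤ᵇ 7 * (weight x + weight y))
                             (start-certified x y)
  in h , sh∈levels , ≤ᵇ⇒≤ h _ h≤

step-level : ∀ {s h} e → (s , h) ∈ levels → Admits s e →
             ∃ λ h′ → (advance s e , h′) ∈ levels × h′ + 3 ≤ h + 7 * weight e
step-level {s} {h} e sh∈levels admitted =
  let h′ , sh′∈levels , climb = rated-sound levels (advance s e) (λ h′ → h′ + 3 ≤ᵇ h + 7 * weight e)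
                                  (All.lookup step-certified sh∈levels e (Equivalence.from (admits-⇔ s e) admitted))
  in h′ , sh′∈levels , ≤ᵇ⇒≤ (h′ + 3) _ climb

end-level : ∀ {s h} → (s , h) ∈ levels → Admits s ∅ → Admits (advance s ∅) ∅ → 10 ≤ h
end-level {s} sh∈levels admitted₁ admitted₂ =
  All.lookup end-certified sh∈levels (Equivalence.from (admits-⇔ s ∅) admitted₁)
    (Equivalence.from (admits-⇔ (advance s ∅) ∅) admitted₂)

-- The lower bound

prefixWeight : (ℕ → Col m) → ℕ → ℕ
prefixWeight c N = sumFin N (λ j → weight (c (toℕ j)))

telescope-step : ∀ {h h₁ h₀ N} w rest → h + 3 * N ≤ h₁ + 7 * rest → h₁ + 3 ≤ h₀ + 7 * w →
                 h + 3 * suc N ≤ h₀ + 7 * (w + rest)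
telescope-step {h} {h₁} {h₀} {N} w rest bound climb = begin
  h + 3 * suc N          ≡⟨ shuffle₁ h N ⟩
  h + 3 * N + 3          ≤⟨ +-monoˡ-≤ 3 bound ⟩
  h₁ + 7 * rest + 3      ≡⟨ shuffle₂ h₁ (7 * rest) 3 ⟩
  h₁ + 3 + 7 * rest      ≤⟨ +-monoˡ-≤ (7 * rest) climb ⟩
  h₀ + 7 * w + 7 * rest  ≡⟨ shuffle₃ h₀ w rest ⟩
  h₀ + 7 * (w + rest)    ∎
  where
  open ≤-Reasoning
  shuffle₁ : ∀ h N → h + 3 * suc N ≡ h + 3 * N + 3
  shuffle₁ = solve-∀
  shuffle₂ : ∀ a b c → a + b + c ≡ a + c + b
  shuffle₂ = solve-∀
  shuffle₃ : ∀ h w r → h + 7 * w + 7 * r ≡ h + 7 * (w + r)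
  shuffle₃ = solve-∀

level-along : ∀ (p : ℕ → Col 4) N {h₀} → (profileAt p 0 , h₀) ∈ levels →
              (∀ K → K < N → Admits (profileAt p K) (p (4 + K))) →
              ∃ λ h → (profileAt p N , h) ∈ levels × h + 3 * N ≤ h₀ + 7 * prefixWeight (p ∘ (4 +_)) N
level-along p zero    {h₀} s₀∈levels _        = h₀ , s₀∈levels , ≤-refl
level-along p (suc N) {h₀} s₀∈levels admitted =
  let h₁ , s₁∈levels , climb = step-level (p 4) s₀∈levels (admitted 0 z<s)
      h , s∈levels , bound = level-along (p ∘ suc) N s₁∈levels (λ K K<N → admitted (suc K) (s<s K<N))
  in h , s∈levels , telescope-step {h₀ = h₀} (weight (p 4)) (prefixWeight (p ∘ (5 +_)) N) bound climb

admitted-weight-bound : ∀ (c : ℕ → Col 4) N →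
                        (∀ K → K < 2 + N → Admits (profileAt (pad c) K) (pad c (4 + K))) →
                        c (2 + N) ≡ ∅ → c (3 + N) ≡ ∅ →
                        10 + 3 * N ≤ 7 * prefixWeight c (2 + N)
admitted-weight-bound c N admitted c₂₊ₙ≡∅ c₃₊ₙ≡∅ =
  let h₀ , s₀∈levels , h₀≤ = start-level (c 0) (c 1)
      h , s∈levels , bound = level-along (pad c) N s₀∈levels λ K K<N → admitted K (≤-trans K<N (m≤n+m N 2))
  in begin
  10 + 3 * N                                    ≤⟨ +-monoˡ-≤ (3 * N) (end-level s∈levels last final) ⟩
  h + 3 * N                                     ≤⟨ bound ⟩
  h₀ + 7 * rest                                 ≤⟨ +-monoˡ-≤ (7 * rest) h₀≤ ⟩
  7 * (weight (c 0) + weight (c 1)) + 7 * rest  ≡⟨ shuffle (weight (c 0)) (weight (c 1)) rest ⟩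
  7 * (weight (c 0) + (weight (c 1) + rest))    ∎
  where
  open ≤-Reasoning
  rest = prefixWeight (c ∘ (2 +_)) N
  sₙ = profileAt (pad c) N
  last : Admits sₙ ∅
  last = subst (Admits sₙ) c₂₊ₙ≡∅ (admitted N (n≤1+n (suc N)))
  final : Admits (advance sₙ ∅) ∅
  final = subst₂ (Admits ∘ advance sₙ) c₂₊ₙ≡∅ c₃₊ₙ≡∅ (admitted (suc N) ≤-refl)
  shuffle : ∀ a b r → 7 * (a + b) + 7 * r ≡ 7 * (a + (b + r))
  shuffle = solve-∀

lower-bound : 2 ≤ n → (S : VSet 4 n) → IsBroadcastDom 3 1 S → 3 * n + 4 ≤ 7 * card S
lower-bound {suc zero}    (s≤s ()) _ _
lower-bound {suc (suc N)} _ S dom = begin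
  3 * (2 + N) + 4                         ≡⟨ shuffle N ⟩
  10 + 3 * N                              ≤⟨ admitted-weight-bound (columnAt S) N (dominating⇒admits S dom)
                                               (columnAt-≥ S ≤-refl) (columnAt-≥ S (n≤1+n _)) ⟩
  7 * prefixWeight (columnAt S) (2 + N)   ≡⟨ cong (7 *_) (sumFin-cong (2 + N) (cong weight ∘ columnAt-toℕ S)) ⟩
  7 * sumFin (2 + N) (weight ∘ column S)  ≡⟨ cong (7 *_) (card-by-columns S) ⟨
  7 * card S                              ∎
  where
  open ≤-Reasoning
  shuffle : ∀ N → 3 * (2 + N) + 4 ≡ 10 + 3 * N
  shuffle = solve-∀

γ : ℕ → ℕ
γ n = (n + 1) / 7 + (n + 3) / 7 + (n + 5) / 7 + 1

/7-shift : ∀ a q → (a + q * 7) / 7 ≡ a / 7 + q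
/7-shift a q = trans (+-distrib-/-∣ʳ a (divides q refl)) (cong (a / 7 +_) (m*n/n≡m q 7))

γ-periodic : ∀ n q → γ (n + q * 7) ≡ γ n + q * 3
γ-periodic n q = begin
  (n + q * 7 + 1) / 7 + (n + q * 7 + 3) / 7 + (n + q * 7 + 5) / 7 + 1
    ≡⟨ cong (_+ 1) (cong₂ _+_ (cong₂ _+_ (shifted 1) (shifted 3)) (shifted 5)) ⟩
  ((n + 1) / 7 + q) + ((n + 3) / 7 + q) + ((n + 5) / 7 + q) + 1
    ≡⟨ collect ((n + 1) / 7) ((n + 3) / 7) ((n + 5) / 7) q ⟩
  γ n + q * 3
    ∎
  where
  open ≡-Reasoning
  swap : ∀ n m c → n + m + c ≡ n + c + m
  swap = solve-∀
  shifted : ∀ c → (n + q * 7 + c) / 7 ≡ (n + c) / 7 + q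
  shifted c = trans (cong (_/ 7) (swap n (q * 7) c)) (/7-shift (n + c) q)
  collect : ∀ a b c q → a + q + (b + q) + (c + q) + 1 ≡ a + b + c + 1 + q * 3
  collect = solve-∀

γ-upper : ∀ n → 7 * γ n ≤ 3 * n + 10
γ-upper n with n divMod 7
... | result q r refl = begin
  7 * γ (toℕ r + q * 7)         ≡⟨ cong (7 *_) (γ-periodic (toℕ r) q) ⟩
  7 * (γ (toℕ r) + q * 3)       ≡⟨ *-distribˡ-+ 7 (γ (toℕ r)) (q * 3) ⟩
  7 * γ (toℕ r) + 7 * (q * 3)   ≤⟨ +-monoˡ-≤ (7 * (q * 3)) (small r) ⟩
  3 * toℕ r + 10 + 7 * (q * 3)  ≡⟨ collect (toℕ r) q ⟩
  3 * (toℕ r + q * 7) + 10      ∎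
  where
  open ≤-Reasoning
  small : ∀ (r : Fin 7) → 7 * γ (toℕ r) ≤ 3 * toℕ r + 10
  small = from-yes (all? {n = 7} λ r → 7 * γ (toℕ r) ≤? 3 * toℕ r + 10)
  collect : ∀ r q → 3 * r + 10 + 7 * (q * 3) ≡ 3 * (r + q * 7) + 10
  collect = solve-∀

γ-least : ∀ n k → 3 * n + 4 ≤ 7 * k → γ n ≤ k
γ-least n k bound = ≤-pred (*-cancelˡ-< 7 (γ n) (suc k) (begin-strict
  7 * γ n        ≤⟨ γ-upper n ⟩
  3 * n + 10     <⟨ +-monoʳ-< (3 * n) (n<1+n 10) ⟩
  3 * n + 11     ≡⟨ +-assoc (3 * n) 4 7 ⟨
  3 * n + 4 + 7  ≤⟨ +-monoˡ-≤ 7 bound ⟩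
  7 * k + 7      ≡⟨ +-comm (7 * k) 7 ⟩
  7 + 7 * k      ≡⟨ *-suc 7 k ⟨
  7 * suc k      ∎))
  where open ≤-Reasoning

fromWord : (W : List (Col m)) → VSet m (length W)
fromWord W (r , k) = lookup (List.lookup W k) r

infixl 9 _!_

_!_ : List (Col m) → ℕ → Col m
[]      ! _     = ∅
(x ∷ _) ! zero  = x
(_ ∷ W) ! suc j = W ! j

totalWeight : List (Col m) → ℕ
totalWeight = List.foldr (λ x w → weight x + w) 0

totalWeight-++ : ∀ (xs ys : List (Col m)) → totalWeight (xs ++ ys) ≡ totalWeight xs + totalWeight ys
totalWeight-++ []       ys = refl
totalWeight-++ (x ∷ xs) ys = trans (cong (weight x +_) (totalWeight-++ xs ys)) (sym (+-assoc (weight x) _ _))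

card-fromWord : (W : List (Col m)) → card (fromWord W) ≡ totalWeight W
card-fromWord W = trans (card-by-columns (fromWord W)) (columns W)
  where
  columns : ∀ W → sumFin (length W) (weight ∘ column (fromWord W)) ≡ totalWeight W
  columns []      = refl
  columns (x ∷ W) = cong₂ _+_ (cong weight (tabulate∘lookup x)) (columns W)

lookup-fromℕ< : ∀ (W : List (Col m)) {j} (j<n : j < length W) → List.lookup W (fromℕ< j<n) ≡ W ! j
lookup-fromℕ< (x ∷ W) {zero}  _         = refl
lookup-fromℕ< (x ∷ W) {suc j} (s<s j<n) = lookup-fromℕ< W j<n

!-≥ : ∀ (W : List (Col m)) {j} → length W ≤ j → W ! j ≡ ∅
!-≥ []      _         = refl
!-≥ (x ∷ W) (s≤s n≤j) = !-≥ W n≤j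

!-++-∅ : ∀ (W : List (Col m)) j → (W ++ ∅ ∷ ∅ ∷ []) ! j ≡ W ! j
!-++-∅ []      zero          = refl
!-++-∅ []      (suc zero)    = refl
!-++-∅ []      (suc (suc j)) = refl
!-++-∅ (x ∷ W) zero          = refl
!-++-∅ (x ∷ W) (suc j)       = !-++-∅ W j

columnAt-fromWord : ∀ (W : List (Col m)) j → columnAt (fromWord W) j ≡ W ! j
columnAt-fromWord W j with j <? length W
... | yes j<n = trans (tabulate∘lookup (List.lookup W (fromℕ< j<n))) (lookup-fromℕ< W j<n)
... | no  j≮n = sym (!-≥ W (≮⇒≥ j≮n))

framed : List (Col m) → List (Col m)
framed W = ∅ ∷ ∅ ∷ W ++ ∅ ∷ ∅ ∷ []

pad-columnAt-fromWord : ∀ (W : List (Col m)) j → pad (columnAt (fromWord W)) j ≡ framed W ! j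
pad-columnAt-fromWord W zero          = refl
pad-columnAt-fromWord W (suc zero)    = refl
pad-columnAt-fromWord W (suc (suc j)) = trans (columnAt-fromWord W j) (sym (!-++-∅ W j))

profileAt-cong : ∀ {p q : ℕ → Col m} → (∀ j → p j ≡ q j) → ∀ K → profileAt p K ≡ profileAt q K
profileAt-cong p≗q K = cong₂ (λ (a , b) (c , d) → profileOf a b c d)
                             (cong₂ _,_ (p≗q K) (p≗q (1 + K))) (cong₂ _,_ (p≗q (2 + K)) (p≗q (3 + K)))

accepts : Profile m → List (Col m) → Bool
accepts s []       = true
accepts s (e ∷ es) = admits s e ∧ accepts (advance s e) es

run : Profile m → List (Col m) → Profile m
run = List.foldl advance

accepts-∷ : ∀ (s : Profile m) e es → T (admits s e) → T (accepts (advance s e) es) → T (accepts s (e ∷ es))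
accepts-∷ s e es okₑ okₑₛ = Equivalence.from (T-∧ {admits s e}) (okₑ , okₑₛ)

accepts-++ : ∀ (s : Profile m) xs ys → T (accepts s xs) → T (accepts (run s xs) ys) → T (accepts s (xs ++ ys))
accepts-++ s []       ys _   ok = ok
accepts-++ s (x ∷ xs) ys okₓ ok =
  let okₓ₀ , okₓₛ = Equivalence.to T-∧ okₓ
  in accepts-∷ s x (xs ++ ys) okₓ₀ (accepts-++ (advance s x) xs ys okₓₛ ok)

accepts-windows : ∀ (L : List (Col m)) → T (accepts (profileAt (L !_) 0) (drop 4 L)) →
                  ∀ K → 5 + K ≤ length L → Admits (profileAt (L !_) K) (L ! (4 + K))
accepts-windows (a ∷ b ∷ c ∷ d ∷ e ∷ L) ok zero    _ =
  Equivalence.to (admits-⇔ (profileOf a b c d) e) (proj₁ (Equivalence.to T-∧ ok))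
accepts-windows (a ∷ b ∷ c ∷ d ∷ e ∷ L) ok (suc K) (s≤s bound) =
  accepts-windows (b ∷ c ∷ d ∷ e ∷ L) (proj₂ (Equivalence.to T-∧ ok)) K bound
accepts-windows []                   _ _ ()
accepts-windows (_ ∷ [])             _ _ (s≤s ())
accepts-windows (_ ∷ _ ∷ [])         _ _ (s≤s (s≤s ()))
accepts-windows (_ ∷ _ ∷ _ ∷ [])     _ _ (s≤s (s≤s (s≤s ())))
accepts-windows (_ ∷ _ ∷ _ ∷ _ ∷ []) _ _ (s≤s (s≤s (s≤s (s≤s ()))))

word-dominating : ∀ (W : List (Col m)) → T (accepts (profileAt (framed W !_) 0) (drop 4 (framed W))) →
                  IsBroadcastDom 3 1 (fromWord W)
word-dominating W ok = admits⇒dominating (fromWord W) λ K K<n →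
  subst₂ Admits (sym (profileAt-cong padded K)) (sym (padded (4 + K)))
    (accepts-windows (framed W) ok K (subst (5 + K ≤_) length-framed (+-monoʳ-≤ 4 K<n)))
  where
  padded = pad-columnAt-fromWord W
  length-framed : 4 + length W ≡ length (framed W)
  length-framed = cong (2 +_) (trans (+-comm 2 (length W)) (sym (length-++ W)))

repeat : ∀ {A : Set} → ℕ → List A → List A
repeat q xs = concat (List.replicate q xs)

length-repeat : ∀ {A : Set} q (xs : List A) → length (repeat q xs) ≡ q * length xs
length-repeat zero    xs = refl
length-repeat (suc q) xs = trans (length-++ xs) (cong (length xs +_) (length-repeat q xs))

totalWeight-repeat : ∀ q (xs : List (Col m)) → totalWeight (repeat q xs) ≡ q * totalWeight xs
totalWeight-repeat zero    xs = refl
totalWeight-repeat (suc q) xs = trans (totalWeight-++ xs _) (cong (totalWeight xs +_) (totalWeight-repeat q xs))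

accepts-repeat : ∀ (s : Profile m) B q ys → run s B ≡ s → T (accepts s B) → T (accepts s ys) →
                 T (accepts s (repeat q B ++ ys))
accepts-repeat s B zero    ys _    _   ok = ok
accepts-repeat s B (suc q) ys back okB ok =
  subst (T ∘ accepts s) (sym (++-assoc B (repeat q B) ys))
    (accepts-++ s B _ okB (subst (λ s′ → T (accepts s′ (repeat q B ++ ys))) (sym back)
                                 (accepts-repeat s B q ys back okB ok)))

-- The upper bound

period : List (Col 4)
period = List.map bits (1 ∷ 8 ∷ 0 ∷ 0 ∷ 2 ∷ 0 ∷ 0 ∷ 8 ∷ 1 ∷ 0 ∷ 0 ∷ 4 ∷ 0 ∷ 0 ∷ [])

-- lead repeats the last three columns of period, so the profile reached after it recurs
-- after every period.
lead : List (Col 4)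
lead = List.map bits (4 ∷ 0 ∷ 0 ∷ [])

closing : Vec (Col 4) 14
closing = map bits (5 ∷ 8 ∷ 1 ∷ 1 ∷ 2 ∷ 2 ∷ 4 ∷ 9 ∷ 1 ∷ 1 ∷ 2 ∷ 4 ∷ 1 ∷ 2 ∷ [])

ending : Fin 14 → List (Col 4)
ending b = take (toℕ b) period ++ lookup closing b ∷ []

word : ℕ → Fin 14 → List (Col 4)
word q b = lead ++ repeat q period ++ ending b

entry-profile : Profile 4
entry-profile = profileOf ∅ ∅ (bits 4) (bits 0)

cycle-profile : Profile 4
cycle-profile = advance entry-profile (bits 0)

opaque
  unfolding spread

  lead-admitted : T (admits entry-profile (bits 0))
  lead-admitted = tt

  period-returns : run cycle-profile period ≡ cycle-profile
  period-returns = refl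

  period-accepted : T (accepts cycle-profile period)
  period-accepted = tt

  ending-accepted : ∀ b → T (accepts cycle-profile (ending b ++ ∅ ∷ ∅ ∷ []))
  ending-accepted = from-yes (all? λ b → T? (accepts cycle-profile (ending b ++ ∅ ∷ ∅ ∷ [])))

ending-size : ∀ b → length (ending b) ≡ suc (toℕ b) ×
                    totalWeight lead + totalWeight (ending b) ≡ γ (4 + toℕ b)
ending-size = from-yes (all? λ b →
  length (ending b) ≟ suc (toℕ b) ×-dec totalWeight lead + totalWeight (ending b) ≟ γ (4 + toℕ b))

word-accepted : ∀ q b → T (accepts (profileAt (framed (word q b) !_) 0) (drop 4 (framed (word q b))))
word-accepted q b =
  accepts-∷ entry-profile (bits 0) ((repeat q period ++ ending b) ++ ∅ ∷ ∅ ∷ []) lead-admitted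
    (subst (T ∘ accepts cycle-profile) (sym (++-assoc (repeat q period) (ending b) (∅ ∷ ∅ ∷ [])))
      (accepts-repeat cycle-profile period q _ period-returns period-accepted (ending-accepted b)))

word-length : ∀ q b → length (word q b) ≡ 4 + toℕ b + q * 2 * 7
word-length q b = begin
  length (word q b)                                   ≡⟨ cong (3 +_) (length-++ (repeat q period)) ⟩
  3 + (length (repeat q period) + length (ending b))  ≡⟨ cong₂ (λ x y → 3 + (x + y))
                                                            (length-repeat q period) (proj₁ (ending-size b)) ⟩
  3 + (q * 14 + suc (toℕ b))                          ≡⟨ collect q (toℕ b) ⟩
  4 + toℕ b + q * 2 * 7                               ∎
  where
  open ≡-Reasoning
  collect : ∀ q b → 3 + (q * 14 + suc b) ≡ 4 + b + q * 2 * 7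
  collect = solve-∀

word-weight : ∀ q b → totalWeight (word q b) ≡ γ (4 + toℕ b + q * 2 * 7)
word-weight q b = begin
  totalWeight (word q b)
    ≡⟨ totalWeight-++ lead (repeat q period ++ ending b) ⟩
  totalWeight lead + totalWeight (repeat q period ++ ending b)
    ≡⟨ cong (totalWeight lead +_) (totalWeight-++ (repeat q period) (ending b)) ⟩
  totalWeight lead + (totalWeight (repeat q period) + totalWeight (ending b))
    ≡⟨ cong (λ x → totalWeight lead + (x + totalWeight (ending b))) (totalWeight-repeat q period) ⟩
  totalWeight lead + (q * 6 + totalWeight (ending b))
    ≡⟨ collect (totalWeight lead) q _ ⟩
  totalWeight lead + totalWeight (ending b) + q * 2 * 3
    ≡⟨ cong (_+ q * 2 * 3) (proj₂ (ending-size b)) ⟩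
  γ (4 + toℕ b) + q * 2 * 3
    ≡⟨ γ-periodic (4 + toℕ b) (q * 2) ⟨
  γ (4 + toℕ b + q * 2 * 7)
    ∎
  where
  open ≡-Reasoning
  collect : ∀ l q e → l + (q * 6 + e) ≡ l + e + q * 2 * 3
  collect = solve-∀

upper-bound : ∀ n → 4 ≤ n → ∃ λ (S : VSet 4 n) → IsBroadcastDom 3 1 S × card S ≡ γ n
upper-bound n 4≤n with (n ∸ 4) divMod 14
... | result q b n∸4≡ =
  subst (λ n → ∃ λ (S : VSet 4 n) → IsBroadcastDom 3 1 S × card S ≡ γ n) length≡n
    (fromWord W , word-dominating W (word-accepted q b) ,
     trans (card-fromWord W) (trans (word-weight q b) (cong γ (sym (word-length q b)))))
  where
  W = word q b
  length≡n : length W ≡ n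
  length≡n = begin
    length W               ≡⟨ word-length q b ⟩
    4 + toℕ b + q * 2 * 7  ≡⟨ collect (toℕ b) q ⟩
    4 + (toℕ b + q * 14)   ≡⟨ cong (4 +_) n∸4≡ ⟨
    4 + (n ∸ 4)            ≡⟨ m+[n∸m]≡n 4≤n ⟩
    n                      ∎
    where
    open ≡-Reasoning
    collect : ∀ b q → 4 + b + q * 2 * 7 ≡ 4 + (b + q * 14)
    collect = solve-∀

mainTheorem5 : ∀ (n : ℕ) → 4 ≤ n →
    BroadcastDomNumber 4 n 3 1
      ((n + 1) / 7 + (n + 3) / 7 + (n + 5) / 7 + 1)
mainTheorem5 n 4≤n =
  upper-bound n 4≤n ,
  λ S dom → γ-least n (card S) (lower-bound (≤-trans (s≤s (s≤s z≤n)) 4≤n) S dom)
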